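{- If $f:Y\rightharpoonup\wp(Z)$ and $g:Z\rightharpoonup\wp(W)$ are partial functions, then $f_*g_*=(fg_*)_*$.
   Context: Relations $\alpha:X\rightharpoonup Y$ are subsets of $X\times Y$ (sets with the axiom of choice); juxtaposition is relational composition; $\sqsubseteq$ inclusion, $\sqcup$ union; $\mathrm{dom}\,\alpha=\{(x,x)\mid\exists y.\,(x,y)\in\alpha\}$; a pfn (partial function) is a univalent relation. For $f:Y\rightharpoonup\wp(Z)$, $(B,A)\in f_\circ$ iff $A=\bigcup\{C\mid\exists b\in B.\,(b,C)\in f\}$. For $v\sqsubseteq\mathrm{id}_Y$, $\hat u_v=\{(A,A)\mid A\subseteq Y,\ \forall a\in A.\,(a,a)\in v\}$. $f\sqsubseteq_c\beta$ means $f\sqsubseteq\beta$, $f$ a pfn, $\mathrm{dom}\,f=\mathrm{dom}\,\beta$. Peleg lifting of $\beta:Y\rightharpoonup\wp(Z)$: $\beta_*=\bigsqcup_{f\sqsubseteq_c\beta}\hat u_{\mathrm{dom}\,\beta}f_\circ$. -}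

module Defs where

open import Level using (Level; _⊔_; suc; zero)
open import Data.Product using (Σ; ∃; ∃-syntax; _×_; _,_)
open import Relation.Binary.PropositionalEquality using (_≡_)

℘ : Set → Set₁
℘ X = X → Set

-- Extensional equality of subsets (possibly of different universe levels); this plays the role of "=" on ℘ X.
_≐_ : ∀ {ℓ₁ ℓ₂} {X : Set} → (X → Set ℓ₁) → (X → Set ℓ₂) → Set (ℓ₁ ⊔ ℓ₂)
A ≐ B = ∀ x → (A x → B x) × (B x → A x)

REL : ∀ {a b} → Set a → Set b → (ℓ : Level) → Set (a ⊔ b ⊔ suc ℓ)
REL A B ℓ = A → B → Set ℓ

-- Relational composition (juxtaposition in the paper).
_⨾_ : ∀ {a b c ℓ₁ ℓ₂} {A : Set a} {B : Set b} {C : Set c} →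
      REL A B ℓ₁ → REL B C ℓ₂ → REL A C (b ⊔ ℓ₁ ⊔ ℓ₂)
(α ⨾ β) x z = ∃[ y ] (α x y × β y z)

_⊑_ : ∀ {a b ℓ₁ ℓ₂} {A : Set a} {B : Set b} → REL A B ℓ₁ → REL A B ℓ₂ → Set (a ⊔ b ⊔ ℓ₁ ⊔ ℓ₂)
α ⊑ β = ∀ x y → α x y → β x y

_≐R_ : ∀ {a b ℓ₁ ℓ₂} {A : Set a} {B : Set b} → REL A B ℓ₁ → REL A B ℓ₂ → Set (a ⊔ b ⊔ ℓ₁ ⊔ ℓ₂)
α ≐R β = (α ⊑ β) × (β ⊑ α)

dom : ∀ {a b ℓ} {A : Set a} {B : Set b} → REL A B ℓ → REL A A (a ⊔ b ⊔ ℓ)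
dom α x x′ = (x ≡ x′) × ∃[ y ] α x y

-- Partial functions into a power set: univalent relations (equality on ℘ Z is ≐).
IsPfn : ∀ {ℓ} {Y Z : Set} → REL Y (℘ Z) ℓ → Set (suc zero ⊔ ℓ)
IsPfn f = ∀ y C C′ → f y C → f y C′ → C ≐ C′

_⊑c_ : ∀ {ℓ₁ ℓ₂} {Y Z : Set} → REL Y (℘ Z) ℓ₁ → REL Y (℘ Z) ℓ₂ → Set (suc zero ⊔ ℓ₁ ⊔ ℓ₂)
f ⊑c β = (f ⊑ β) × IsPfn f × (dom f ≐R dom β)

_∘ : ∀ {ℓ} {Y Z : Set} → REL Y (℘ Z) ℓ → REL (℘ Y) (℘ Z) (suc zero ⊔ ℓ)
(f ∘) B A = A ≐ (λ z → ∃[ b ] ∃[ C ] (B b × f b C × C z))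

û : ∀ {ℓ} {Y : Set} → REL Y Y ℓ → REL (℘ Y) (℘ Y) ℓ
û v A A′ = (A ≐ A′) × (∀ a → A a → v a a)

-- Peleg lifting: β* = ⋃_{f ⊑c β} û_{dom β} f∘.
_* : ∀ {ℓ} {Y Z : Set} → REL Y (℘ Z) ℓ → REL (℘ Y) (℘ Z) (suc (suc zero) ⊔ suc ℓ)
_* {ℓ} {Y} {Z} β A A′ = ∃[ f ] ((f ⊑c β) × (û (dom β) ⨾ (f ∘)) A A′)

-- For a partial function β the Peleg lifting is itself a partial function: β* relates A to
-- ⋃ {C | a ∈ A, (a, C) ∈ β} exactly when A ⊆ dom β. With this description both sides of the
-- proposition relate A to ⋃ {g-images of f-images of A}, under the same domain condition.
module Submission where

open import Defs
open import Level using (Level; zero; _⊔_; Lift; lift; lower)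
open import Data.Product using (Σ; ∃; ∃-syntax; _×_; _,_; proj₁; proj₂)
open import Relation.Binary.PropositionalEquality using (refl)
open import Relation.Unary using (Pred; _⊆_)

private variable
  a b c ℓ ℓ′ : Level
  Y Z W : Set

≐-refl : {A : Y → Set a} → A ≐ A
≐-refl y = (λ p → p) , (λ p → p)

≐-sym : {A : Y → Set a} {B : Y → Set b} → A ≐ B → B ≐ A
≐-sym A≐B y = proj₂ (A≐B y) , proj₁ (A≐B y)

≐-trans : {A : Y → Set a} {B : Y → Set b} {C : Y → Set c} → A ≐ B → B ≐ C → A ≐ C
≐-trans A≐B B≐C y = (λ p → proj₁ (B≐C y) (proj₁ (A≐B y) p)) ,
                    (λ p → proj₂ (A≐B y) (proj₂ (B≐C y) p))

Dom : {A : Set a} {B : Set b} → REL A B ℓ → Pred A (b ⊔ ℓ)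
Dom β x = ∃ (β x)

⨾-Dom : {A : Set a} {B : Set b} {C : Set c} {α : REL A B ℓ} {β : REL B C ℓ′} →
        Dom (α ⨾ β) ⊆ Dom α
⨾-Dom (_ , y , αxy , _) = y , αxy

⋃image : REL Y (℘ Z) ℓ → (Y → Set a) → Z → Set (Level.suc zero ⊔ a ⊔ ℓ)
⋃image β A z = ∃[ y ] ∃[ C ] (A y × β y C × C z)

⋃image-cong : {β : REL Y (℘ Z) ℓ} {A : Y → Set a} {A′ : Y → Set b} →
              A ≐ A′ → ⋃image β A ≐ ⋃image β A′
⋃image-cong A≐A′ z = (λ (y , C , Ay , βyC , Cz) → y , C , proj₁ (A≐A′ y) Ay , βyC , Cz) ,
                     (λ (y , C , Ay , βyC , Cz) → y , C , proj₂ (A≐A′ y) Ay , βyC , Cz)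

⊆⋃image : {β : REL Y (℘ Z) ℓ} {A : Y → Set a} {y : Y} {C : ℘ Z} →
          A y → β y C → C ⊆ ⋃image β A
⊆⋃image Ay βyC Cz = _ , _ , Ay , βyC , Cz

⊑c⇒⋃image≐ : {h : REL Y (℘ Z) ℓ} {β : REL Y (℘ Z) ℓ′} → IsPfn β → h ⊑c β →
             (A : Y → Set a) → ⋃image h A ≐ ⋃image β A
⊑c⇒⋃image≐ {h = h} {β} pβ (h⊑β , _ , _ , domβ⊑domh) A z = to , from
  where
  to : ⋃image h A z → ⋃image β A z
  to (y , C , Ay , hyC , Cz) = y , C , Ay , h⊑β y C hyC , Cz
  from : ⋃image β A z → ⋃image h A z
  from (y , C , Ay , βyC , Cz) with domβ⊑domh y y (refl , C , βyC)
  ... | _ , C′ , hyC′ = y , C′ , Ay , hyC′ , proj₁ (pβ y C C′ βyC (h⊑β y C′ hyC′) z) Cz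

Lift⊑c : {β : REL Y (℘ Z) ℓ} → IsPfn β → (λ y C → Lift (Level.suc zero) (β y C)) ⊑c β
Lift⊑c pβ = (λ _ _ → lower) ,
            (λ y C C′ p q → pβ y C C′ (lower p) (lower q)) ,
            (λ { y .y (refl , C , p) → refl , C , lower p }) ,
            (λ { y .y (refl , C , p) → refl , C , lift p })

*⇒⊆Dom : {β : REL Y (℘ Z) ℓ} {A : ℘ Y} {A′ : ℘ Z} → (β *) A A′ → A ⊆ Dom β
*⇒⊆Dom (_ , _ , _ , (_ , A⊆domβ) , _) Ay = proj₂ (A⊆domβ _ Ay)

*⇒≐⋃image : {β : REL Y (℘ Z) ℓ} {A : ℘ Y} {A′ : ℘ Z} → IsPfn β →
            (β *) A A′ → A′ ≐ ⋃image β A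
*⇒≐⋃image {A = A} pβ (h , h⊑cβ , B , (A≐B , _) , A′≐⋃hB) =
  ≐-trans A′≐⋃hB (≐-trans (⋃image-cong (≐-sym A≐B)) (⊑c⇒⋃image≐ pβ h⊑cβ A))

⊆Dom⇒* : {β : REL Y (℘ Z) ℓ} {A : ℘ Y} {A′ : ℘ Z} → IsPfn β →
         A ⊆ Dom β → A′ ≐ ⋃image β A → (β *) A A′
⊆Dom⇒* {A = A} pβ A⊆Domβ A′≐⋃βA =
  _ , Lift⊑c pβ , A , (≐-refl , λ _ Ay → refl , A⊆Domβ Ay) ,
  ≐-trans A′≐⋃βA (≐-sym (⊑c⇒⋃image≐ pβ (Lift⊑c pβ) A))

-- The union is formed from one chosen value per point, so that it is again a (small) subset of Z.
*-total : {β : REL Y (℘ Z) ℓ} {A : ℘ Y} → IsPfn β → A ⊆ Dom β → ∃ ((β *) A)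
*-total {β = β} {A} pβ A⊆Domβ = ⋃chosen , ⊆Dom⇒* pβ A⊆Domβ ⋃chosen≐⋃βA
  where
  ⋃chosen : ℘ _
  ⋃chosen z = ∃[ y ] Σ (A y) λ Ay → proj₁ (A⊆Domβ Ay) z
  ⋃chosen≐⋃βA : ⋃chosen ≐ ⋃image β A
  ⋃chosen≐⋃βA z =
    (λ (y , Ay , Cz) → y , _ , Ay , proj₂ (A⊆Domβ Ay) , Cz) ,
    (λ (y , C , Ay , βyC , Cz) →
       y , Ay , proj₁ (pβ y C _ βyC (proj₂ (A⊆Domβ Ay)) z) Cz)

module _ {f : REL Y (℘ Z) ℓ} {g : REL Z (℘ W) ℓ′} (pf : IsPfn f) (pg : IsPfn g) where

  ⨾*-isPfn : IsPfn (f ⨾ (g *))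
  ⨾*-isPfn y D D′ (C , fyC , gCD) (C′ , fyC′ , gC′D′) =
    ≐-trans (*⇒≐⋃image pg gCD)
      (≐-trans (⋃image-cong (pf y C C′ fyC fyC′)) (≐-sym (*⇒≐⋃image pg gC′D′)))

  ⊆Dom-⨾* : {A : ℘ Y} → A ⊆ Dom f → ⋃image f A ⊆ Dom g → A ⊆ Dom (f ⨾ (g *))
  ⊆Dom-⨾* A⊆Domf ⋃fA⊆Domg Ay with A⊆Domf Ay
  ... | C , fyC with *-total pg (λ Cz → ⋃fA⊆Domg (⊆⋃image Ay fyC Cz))
  ...   | D , gCD = D , C , fyC , gCD

  Dom-⨾*⇒⋃image⊆Dom : {A : ℘ Y} → A ⊆ Dom (f ⨾ (g *)) → ⋃image f A ⊆ Dom g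
  Dom-⨾*⇒⋃image⊆Dom A⊆Dom {z} (y , C , Ay , fyC , Cz) with A⊆Dom Ay
  ... | _ , C′ , fyC′ , gC′D = *⇒⊆Dom gC′D (proj₁ (pf y C C′ fyC fyC′ z) Cz)

  ⋃image-⨾* : {A : ℘ Y} → A ⊆ Dom (f ⨾ (g *)) →
              ⋃image (f ⨾ (g *)) A ≐ ⋃image g (⋃image f A)
  ⋃image-⨾* {A} A⊆Dom w = to , from
    where
    to : ⋃image (f ⨾ (g *)) A w → ⋃image g (⋃image f A) w
    to (y , D , Ay , (C , fyC , gCD) , Dw) with proj₁ (*⇒≐⋃image pg gCD w) Dw
    ... | z , E , Cz , gzE , Ew = z , E , (y , C , Ay , fyC , Cz) , gzE , Ew
    from : ⋃image g (⋃image f A) w → ⋃image (f ⨾ (g *)) A w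
    from (z , E , (y , C , Ay , fyC , Cz) , gzE , Ew) with A⊆Dom Ay
    ... | D , C′ , fyC′ , gC′D =
      y , D , Ay , (C′ , fyC′ , gC′D) ,
      proj₂ (*⇒≐⋃image pg gC′D w) (z , E , proj₁ (pf y C C′ fyC fyC′ z) Cz , gzE , Ew)

proposition7p4 : {Y Z W : Set} (f : REL Y (℘ Z) zero) (g : REL Z (℘ W) zero) →
    IsPfn f → IsPfn g →
    ((f *) ⨾ (g *)) ≐R ((f ⨾ (g *)) *)
proposition7p4 f g pf pg = lhs⊑rhs , rhs⊑lhs
  where
  lhs⊑rhs : ((f *) ⨾ (g *)) ⊑ ((f ⨾ (g *)) *)
  lhs⊑rhs A D (B , fAB , gBD) =
    ⊆Dom⇒* (⨾*-isPfn pf pg) A⊆Dom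
      (≐-trans (*⇒≐⋃image pg gBD)
        (≐-trans (⋃image-cong B≐⋃fA) (≐-sym (⋃image-⨾* pf pg A⊆Dom))))
    where
    B≐⋃fA : B ≐ ⋃image f A
    B≐⋃fA = *⇒≐⋃image pf fAB
    A⊆Dom : A ⊆ Dom (f ⨾ (g *))
    A⊆Dom = ⊆Dom-⨾* pf pg (*⇒⊆Dom fAB) (λ p → *⇒⊆Dom gBD (proj₂ (B≐⋃fA _) p))

  rhs⊑lhs : ((f ⨾ (g *)) *) ⊑ ((f *) ⨾ (g *))
  rhs⊑lhs A D FAD with *-total pf (λ Ay → ⨾-Dom {α = f} (*⇒⊆Dom FAD Ay))
  ... | B , fAB = B , fAB , ⊆Dom⇒* pg B⊆Domg
                  (≐-trans (*⇒≐⋃image (⨾*-isPfn pf pg) FAD)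
                    (≐-trans (⋃image-⨾* pf pg (*⇒⊆Dom FAD)) (⋃image-cong (≐-sym B≐⋃fA))))
    where
    B≐⋃fA : B ≐ ⋃image f A
    B≐⋃fA = *⇒≐⋃image pf fAB
    B⊆Domg : B ⊆ Dom g
    B⊆Domg Bz = Dom-⨾*⇒⋃image⊆Dom pf pg (*⇒⊆Dom FAD) (proj₁ (B≐⋃fA _) Bz)
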